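{- Let $G$ be a claw-free 4-regular 4-star colourable graph. Then $G$ is the line graph of a bipartite graph, and in particular $G$ is odd-hole-free.
   Context: Graphs are finite and simple. Claw-free means no induced $K_{1,3}$. A 4-star colouring is a proper colouring with 4 colours such that the subgraph induced by any two colour classes has every component a star. Odd-hole-free means $G$ has no induced cycle $C_{2q+3}$ for any positive integer $q$. -}

module Defs where

open import Data.Nat using (ℕ; zero; suc; _+_; _*_)
open import Data.Bool using (Bool; true; false; if_then_else_)
open import Data.Fin using (Fin; toℕ)
open import Data.List using (List; map)
open import Data.Nat.ListAction using (sum)
open import Data.List.Base using (allFin)
open import Data.Product using (Σ; ∃; ∃-syntax; _×_; _,_)
open import Data.Sum using (_⊎_)
open import Relation.Binary.PropositionalEquality using (_≡_; _≢_)
open import Relation.Nullary using (¬_)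
open import Function.Definitions using (Injective)

record Graph (n : ℕ) : Set where
  field
    adj   : Fin n → Fin n → Bool
    sym   : ∀ u v → adj u v ≡ adj v u
    irrefl : ∀ v → adj v v ≡ false

open Graph public

Adj : ∀ {n} → Graph n → Fin n → Fin n → Set
Adj G u v = adj G u v ≡ true

degree : ∀ {n} → Graph n → Fin n → ℕ
degree {n} G v = sum (map (λ u → if adj G v u then 1 else 0) (allFin n))

Regular : ∀ {n} → ℕ → Graph n → Set
Regular k G = ∀ v → degree G v ≡ k

ClawFree : ∀ {n} → Graph n → Set
ClawFree {n} G = ¬ (Σ (Fin n) λ v → Σ (Fin n) λ a → Σ (Fin n) λ b → Σ (Fin n) λ c →
  Adj G v a × Adj G v b × Adj G v c ×
  a ≢ b × a ≢ c × b ≢ c ×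
  adj G a b ≡ false × adj G a c ≡ false × adj G b c ≡ false)

data Reach {n} (G : Graph n) (S : Fin n → Set) : Fin n → Fin n → Set where
  here : ∀ {u} → S u → Reach G S u u
  step : ∀ {u v w} → Reach G S u v → Adj G v w → S w → Reach G S u w

-- every connected component of the subgraph induced by S is a star:
-- each component (the vertices reachable from some u ∈ S) has a centre c
-- such that every edge of the component is incident with c
-- (this includes the stars K_1 and K_2)
StarForest : ∀ {n} → Graph n → (Fin n → Set) → Set
StarForest {n} G S = ∀ u → S u →
  Σ (Fin n) λ c → Reach G S u c ×
    (∀ x y → Reach G S u x → Reach G S u y → Adj G x y → (x ≡ c ⊎ y ≡ c))

ProperColouring : ∀ {n k} → Graph n → (Fin n → Fin k) → Set
ProperColouring G f = ∀ u v → Adj G u v → f u ≢ f v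

IsStarColouring : ∀ {n k} → Graph n → (Fin n → Fin k) → Set
IsStarColouring {n} {k} G f = ProperColouring G f ×
  (∀ (i j : Fin k) → StarForest G (λ v → f v ≡ i ⊎ f v ≡ j))

StarColourable : ∀ {n} → ℕ → Graph n → Set
StarColourable {n} k G = Σ (Fin n → Fin k) λ f → IsStarColouring G f

-- G is (isomorphic to) the line graph of a bipartite graph H:
-- H is a graph on Fin m with a bipartition side : Fin m → Bool (every edge
-- joins the two sides); each edge of H is written uniquely as (a , b) with
-- side a ≡ false, side b ≡ true; e is a bijection from V(G) to E(H), and
-- two distinct vertices of G are adjacent iff their edges share an end.
IsLineGraphOfBipartite : ∀ {n} → Graph n → Set
IsLineGraphOfBipartite {n} G =
  Σ ℕ λ m → Σ (Graph m) λ H → Σ (Fin m → Bool) λ side →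
    (∀ a b → Adj H a b → side a ≢ side b) ×
    Σ (Fin n → Fin m × Fin m) λ e →
      (∀ v → let (a , b) = e v in Adj H a b × side a ≡ false × side b ≡ true) ×
      Injective _≡_ _≡_ e ×
      (∀ a b → Adj H a b → side a ≡ false → ∃[ v ] e v ≡ (a , b)) ×
      (∀ u v → u ≢ v →
        let (a , b) = e u ; (c , d) = e v in
        (Adj G u v → (a ≡ c ⊎ b ≡ d)) × ((a ≡ c ⊎ b ≡ d) → Adj G u v))

CycAdj : (k : ℕ) → Fin k → Fin k → Set
CycAdj k i j =
  suc (toℕ i) ≡ toℕ j ⊎ suc (toℕ j) ≡ toℕ i ⊎
  (toℕ i ≡ 0 × suc (toℕ j) ≡ k) ⊎ (toℕ j ≡ 0 × suc (toℕ i) ≡ k)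

InducedCycle : ∀ {n} → Graph n → (k : ℕ) → Set
InducedCycle {n} G k = Σ (Fin k → Fin n) λ c →
  Injective _≡_ _≡_ c ×
  (∀ i j → (Adj G (c i) (c j) → CycAdj k i j) × (CycAdj k i j → Adj G (c i) (c j)))

OddHoleFree : ∀ {n} → Graph n → Set
OddHoleFree G = ∀ (q : ℕ) → 1 Data.Nat.≤ q → ¬ InducedCycle G (2 * q + 3)

-- The four neighbours of a vertex v avoid the colour of v, so two of
-- them share a colour; claw-freeness and the absence of bicoloured paths on four vertices force
-- the pattern a, a′ (same colour, "heavy") and b, c (two further colours, "light"). No edge is
-- heavy at both ends, and since every vertex has two light neighbours but four edges, double
-- counting shows that every edge is light at exactly one end. Hence N(v) splits into triangles
-- v α b and v α′ c, each cyclically oriented by the heavy relation. Labelling a triangle with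
-- the sign of (its colours in cyclic order, the missing colour) gives the two triangles at v
-- different labels, so the triangles of either label are the two sides of a bipartite graph
-- whose line graph is G. In such a line graph, consecutive edges of an induced cycle share
-- ends on alternating sides, so every induced cycle of length at least 4 is even.
module Submission where

open import Defs renaming (sym to adj-sym; irrefl to adj-irrefl)
open import Data.Nat using (ℕ; zero; suc; _+_; _*_; _≤_; _<_; s≤s; z≤n; _<ᵇ_; _≡ᵇ_; _%_)
open import Data.Nat.Properties
  using ( +-0-commutativeMonoid; +-suc; +-comm; +-identityʳ; +-mono-≤; +-monoʳ-≤; +-cancelˡ-≡; +-cancelʳ-≤
        ; ≤-refl; ≤-antisym; n≤1+n; <⇒≤; m≤n⇒m≤1+n; m≤m+n; m≤n+m; m≢1+n+m; 1+n≢n; module ≤-Reasoning)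
open import Data.Bool using (Bool; true; false; if_then_else_; not; _xor_)
open import Data.Bool.Properties using (¬-not; not-involutive) renaming (_≟_ to _≟ᵇ_)
open import Data.Fin using (Fin; toℕ; cast; _↑ˡ_; _↑ʳ_; splitAt) renaming (_≟_ to _≟ᶠ_)
open import Data.Fin.Properties
  using (any?; all?; cast-involutive; pigeonhole; <⇒≢; ↑ˡ-injective; ↑ʳ-injective; splitAt-↑ˡ; splitAt-↑ʳ)
open import Data.List using (List; []; _∷_; map; length; filter; lookup; allFin; tabulate)
open import Data.List.Properties using (map-tabulate)
open import Algebra.Properties.CommutativeMonoid.Sum +-0-commutativeMonoid
  using (sum-syntax; ∑-distrib-+; ∑-comm; sum-cong-≗; sum-replicate-zero)
open import Data.Nat.ListAction using (sum)
open import Data.List.Membership.Propositional.Properties using (∈-allFin; ∈-filter⁺; ∈-filter⁻; ∈-lookup)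
open import Data.List.Relation.Unary.Any as Any using (Any; index) renaming (tail to Any-tail)
open import Data.List.Relation.Unary.Any.Properties using (lookup-index)
open import Data.List.Relation.Unary.All as All using ()
open import Data.List.Relation.Unary.AllPairs using (_∷_)
open import Data.List.Relation.Unary.Unique.Propositional using (Unique)
open import Data.List.Relation.Unary.Unique.Propositional.Properties using (allFin⁺; filter⁺)
open import Data.Product using (∃; ∃₂; _×_; _,_; proj₁; proj₂; map₂)
open import Data.Sum using (_⊎_; inj₁; inj₂; [_,_]′; swap)
open import Data.Empty using (⊥; ⊥-elim)
open import Data.Unit using (tt)
open import Function using (_∘_; id; const; mk⇔)
open import Function.Definitions using (Injective)
open import Relation.Binary.PropositionalEquality
open import Relation.Nullary using (¬_; Dec; yes; no; does; ¬?; contradiction)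
open import Relation.Nullary.Decidable using (dec-true; dec-false; does-⇔; toWitness; _×-dec_; _⊎-dec_; _→-dec_)
open import Relation.Unary using (Pred; Decidable)
open import Relation.Binary using (IsEquivalence)
open import Level using (0ℓ)

module _ {n : ℕ} (G : Graph n) where

  Adj-sym : ∀ {u v} → Adj G u v → Adj G v u
  Adj-sym {u} {v} uv = trans (adj-sym G v u) uv

  Adj-irrefl : ∀ {u v} → Adj G u v → u ≢ v
  Adj-irrefl {u} uv refl with trans (sym uv) (adj-irrefl G u)
  ... | ()

  Adj? : ∀ u → Decidable (Adj G u)
  Adj? u v = adj G u v ≟ᵇ true

  neighbours : Fin n → List (Fin n)
  neighbours v = filter (Adj? v) (allFin n)

count≡length-filter : ∀ {A : Set} (p : A → Bool) (xs : List A) →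
  sum (map (λ x → if p x then 1 else 0) xs) ≡ length (filter (λ x → p x ≟ᵇ true) xs)
count≡length-filter p [] = refl
count≡length-filter p (x ∷ xs) with p x
... | true = cong suc (count≡length-filter p xs)
... | false = count≡length-filter p xs

lookup-injective : ∀ {A : Set} {xs : List A} → Unique xs → Injective _≡_ _≡_ (lookup xs)
lookup-injective {xs = _ ∷ _} _ {Fin.zero} {Fin.zero} _ = refl
lookup-injective (x∉xs ∷ _) {Fin.zero} {Fin.suc j} eq = ⊥-elim (All.lookup x∉xs (∈-lookup j) eq)
lookup-injective (x∉xs ∷ _) {Fin.suc i} {Fin.zero} eq = ⊥-elim (All.lookup x∉xs (∈-lookup i) (sym eq))
lookup-injective (_ ∷ u) {Fin.suc i} {Fin.suc j} eq = cong Fin.suc (lookup-injective u eq)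

sum-tabulate : ∀ {n} (g : Fin n → ℕ) → sum (tabulate g) ≡ ∑[ i < n ] g i
sum-tabulate {zero} g = refl
sum-tabulate {suc n} g = cong (g Fin.zero +_) (sum-tabulate (g ∘ Fin.suc))

∑-mono-≤ : ∀ {n} {g h : Fin n → ℕ} → (∀ i → g i ≤ h i) → ∑[ i < n ] g i ≤ ∑[ i < n ] h i
∑-mono-≤ {zero} g≤h = z≤n
∑-mono-≤ {suc n} g≤h = +-mono-≤ (g≤h Fin.zero) (∑-mono-≤ (g≤h ∘ Fin.suc))

+-≡∧≤⇒≡ : ∀ {a b c d} → a ≤ b → c ≤ d → a + c ≡ b + d → a ≡ b × c ≡ d
+-≡∧≤⇒≡ {a} {b} {c} {d} a≤b c≤d eq = a≡b , +-cancelˡ-≡ a c d (trans eq (cong (_+ d) (sym a≡b)))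
  where
  open ≤-Reasoning
  a≡b : a ≡ b
  a≡b = ≤-antisym a≤b (+-cancelʳ-≤ c b a (begin
    b + c ≤⟨ +-monoʳ-≤ b c≤d ⟩
    b + d ≡⟨ sym eq ⟩
    a + c ∎))

∑-≡∧≤⇒≗ : ∀ {n} {g h : Fin n → ℕ} → (∀ i → g i ≤ h i) →
  ∑[ i < n ] g i ≡ ∑[ i < n ] h i → g ≗ h
∑-≡∧≤⇒≗ {suc n} g≤h eq Fin.zero =
  proj₁ (+-≡∧≤⇒≡ (g≤h Fin.zero) (∑-mono-≤ (g≤h ∘ Fin.suc)) eq)
∑-≡∧≤⇒≗ {suc n} g≤h eq (Fin.suc i) =
  ∑-≡∧≤⇒≗ (g≤h ∘ Fin.suc) (proj₂ (+-≡∧≤⇒≡ (g≤h Fin.zero) (∑-mono-≤ (g≤h ∘ Fin.suc)) eq)) i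

indicator : ∀ {n} → Fin n → Fin n → ℕ
indicator x u = if does (u ≟ᶠ x) then 1 else 0

∑-indicator : ∀ {n} (x : Fin n) → ∑[ u < n ] indicator x u ≡ 1
∑-indicator {suc n} Fin.zero = cong suc (sum-replicate-zero n)
∑-indicator {suc n} (Fin.suc x) = ∑-indicator x

first : ∀ {A : Set} {P : Pred A 0ℓ} → Decidable P → A → List A → A
first P? d [] = d
first P? d (x ∷ xs) = if does (P? x) then x else first P? d xs

first-satisfies : ∀ {A : Set} {P : Pred A 0ℓ} (P? : Decidable P) d {xs} → Any P xs → P (first P? d xs)
first-satisfies P? d {x ∷ xs} some with P? x
... | yes px = px
... | no ¬px = first-satisfies P? d (Any-tail ¬px some)

first-cong : ∀ {A : Set} {P Q : Pred A 0ℓ} (P? : Decidable P) (Q? : Decidable Q) d d′ {xs} →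
  (∀ {x} → P x → Q x) → (∀ {x} → Q x → P x) → Any P xs → first P? d xs ≡ first Q? d′ xs
first-cong P? Q? d d′ {x ∷ xs} P⇒Q Q⇒P some with P? x | Q? x
... | yes _ | yes _ = refl
... | yes px | no ¬qx = ⊥-elim (¬qx (P⇒Q px))
... | no ¬px | yes qx = ⊥-elim (¬px (Q⇒P qx))
... | no ¬px | no _ = first-cong P? Q? d d′ P⇒Q Q⇒P (Any-tail ¬px some)

module Representative {n : ℕ} {R : Fin n → Fin n → Set}
  (R? : ∀ x → Decidable (R x)) (R-equiv : IsEquivalence R) where
  open IsEquivalence R-equiv renaming (refl to R-refl; sym to R-sym; trans to R-trans)

  representative : Fin n → Fin n
  representative x = first (R? x) x (allFin n)

  related-representative : ∀ x → R x (representative x)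
  related-representative x = first-satisfies (R? x) x (Any.map (λ { refl → R-refl }) (∈-allFin x))

  representative-cong : ∀ {x y} → R x y → representative x ≡ representative y
  representative-cong {x} {y} xRy = first-cong (R? x) (R? y) x y (R-trans (R-sym xRy)) (R-trans xRy)
    (Any.map (λ { refl → R-refl }) (∈-allFin x))

  representative-injective : ∀ {x y} → representative x ≡ representative y → R x y
  representative-injective {x} {y} eq =
    R-trans (related-representative x) (R-sym (subst (R y) (sym eq) (related-representative y)))

_≉?_ : ∀ {n} (x y : Fin n) → Dec (x ≢ y)
x ≉? y = ¬? (x ≟ᶠ y)

abstract
  pair-complement : ∀ (i j : Fin 4) → i ≢ j → ∃₂ λ k l →
    (k ≢ l × k ≢ i × k ≢ j × l ≢ i × l ≢ j) × (∀ m → m ≡ i ⊎ m ≡ j ⊎ m ≡ k ⊎ m ≡ l)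
  pair-complement = toWitness {a? = all? λ i → all? λ j → i ≉? j →-dec
    any? λ k → any? λ l →
      (k ≉? l ×-dec k ≉? i ×-dec k ≉? j ×-dec l ≉? i ×-dec l ≉? j) ×-dec
      all? λ m → m ≟ᶠ i ⊎-dec m ≟ᶠ j ⊎-dec m ≟ᶠ k ⊎-dec m ≟ᶠ l} tt

  no-five-distinct : ∀ (c₀ c₁ c₂ c₃ c₄ : Fin 4) →
    c₀ ≢ c₁ → c₀ ≢ c₂ → c₀ ≢ c₃ → c₀ ≢ c₄ →
    c₁ ≢ c₂ → c₁ ≢ c₃ → c₁ ≢ c₄ → c₂ ≢ c₃ → c₂ ≢ c₄ → c₃ ≢ c₄ → ⊥
  no-five-distinct = toWitness {a? = all? λ c₀ → all? λ c₁ → all? λ c₂ → all? λ c₃ → all? λ c₄ →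
    c₀ ≉? c₁ →-dec c₀ ≉? c₂ →-dec c₀ ≉? c₃ →-dec c₀ ≉? c₄ →-dec
    c₁ ≉? c₂ →-dec c₁ ≉? c₃ →-dec c₁ ≉? c₄ →-dec c₂ ≉? c₃ →-dec c₂ ≉? c₄ →-dec c₃ ≉? c₄ →-dec
    no λ ()} tt

-- For distinct x, y, z: the sign of the permutation (x, y, z, w) of 0 1 2 3, w being the missing value.
orientation : Fin 4 → Fin 4 → Fin 4 → Bool
orientation x y z = (y <ᶠ x) xor (z <ᶠ y) xor (x <ᶠ z) xor ((toℕ x + toℕ y + toℕ z) % 2 ≡ᵇ 1)
  where
  _<ᶠ_ : Fin 4 → Fin 4 → Bool
  i <ᶠ j = toℕ i <ᵇ toℕ j

abstract
  orientation-rotate : ∀ x y z → orientation x y z ≡ orientation y z x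
  orientation-rotate = toWitness {a? = all? λ x → all? λ y → all? λ z →
    orientation x y z ≟ᵇ orientation y z x} tt

  orientation-swap : ∀ x y z w → x ≢ y → x ≢ z → x ≢ w → y ≢ z → y ≢ w → z ≢ w →
    orientation x y z ≢ orientation x y w
  orientation-swap = toWitness {a? = all? λ x → all? λ y → all? λ z → all? λ w →
    x ≉? y →-dec x ≉? z →-dec x ≉? w →-dec y ≉? z →-dec y ≉? w →-dec z ≉? w →-dec
    ¬? (orientation x y z ≟ᵇ orientation x y w)} tt

module _ {n : ℕ} (G : Graph n) where

  record Neighbourhood (v p q r s : Fin n) : Set where
    field
      vp : Adj G v p
      vq : Adj G v q
      vr : Adj G v r
      vs : Adj G v s
      p≢q : p ≢ q
      p≢r : p ≢ r
      p≢s : p ≢ s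
      q≢r : q ≢ r
      q≢s : q ≢ s
      r≢s : r ≢ s
      cover : ∀ {u} → Adj G v u → u ≡ p ⊎ u ≡ q ⊎ u ≡ r ⊎ u ≡ s

  module _ (regular : Regular 4 G) (v : Fin n) where

    private
      length-neighbours : length (neighbours G v) ≡ 4
      length-neighbours = trans (sym (count≡length-filter (adj G v) (allFin n))) (regular v)

    neighbour : Fin 4 → Fin n
    neighbour i = lookup (neighbours G v) (cast (sym length-neighbours) i)

    neighbour-adj : ∀ i → Adj G v (neighbour i)
    neighbour-adj i = proj₂ (∈-filter⁻ (Adj? G v) {xs = allFin n} (∈-lookup {xs = neighbours G v} _))

    neighbour-injective : Injective _≡_ _≡_ neighbour
    neighbour-injective {i} {j} eq = begin
      i                  ≡⟨ cast-involutive ℓ≡4 (sym ℓ≡4) i ⟨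
      cast ℓ≡4 (cast (sym ℓ≡4) i) ≡⟨ cong (cast ℓ≡4) (lookup-injective (filter⁺ (Adj? G v) (allFin⁺ n)) eq) ⟩
      cast ℓ≡4 (cast (sym ℓ≡4) j) ≡⟨ cast-involutive ℓ≡4 (sym ℓ≡4) j ⟩
      j                  ∎
      where
      open ≡-Reasoning
      ℓ≡4 = length-neighbours

    neighbour-surjective : ∀ {u} → Adj G v u → ∃ λ i → neighbour i ≡ u
    neighbour-surjective {u} vu = cast length-neighbours (index u∈) , (begin
      neighbour (cast length-neighbours (index u∈)) ≡⟨ cong (lookup (neighbours G v))
                                                          (cast-involutive (sym length-neighbours) length-neighbours (index u∈)) ⟩
      lookup (neighbours G v) (index u∈)            ≡⟨ lookup-index u∈ ⟨
      u                                             ∎)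
      where
      open ≡-Reasoning
      u∈ = ∈-filter⁺ (Adj? G v) (∈-allFin u) vu

    neighbourhood : ∀ {p q} → Adj G v p → Adj G v q → p ≢ q → ∃₂ λ r s → Neighbourhood v p q r s
    neighbourhood {p} {q} vp vq p≢q
      with i , refl ← neighbour-surjective vp | j , refl ← neighbour-surjective vq
      with k , l , (k≢l , k≢i , k≢j , l≢i , l≢j) , complete ← pair-complement i j (p≢q ∘ cong neighbour)
      = neighbour k , neighbour l , record
        { vp = vp ; vq = vq ; vr = neighbour-adj k ; vs = neighbour-adj l
        ; p≢q = p≢q ; p≢r = distinct (k≢i ∘ sym) ; p≢s = distinct (l≢i ∘ sym)
        ; q≢r = distinct (k≢j ∘ sym) ; q≢s = distinct (l≢j ∘ sym) ; r≢s = distinct k≢l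
        ; cover = cover }
      where
      distinct : ∀ {a b} → a ≢ b → neighbour a ≢ neighbour b
      distinct a≢b = a≢b ∘ neighbour-injective
      cover : ∀ {u} → Adj G v u → u ≡ neighbour i ⊎ u ≡ neighbour j ⊎ u ≡ neighbour k ⊎ u ≡ neighbour l
      cover vu with m , refl ← neighbour-surjective vu with complete m
      ... | inj₁ refl = inj₁ refl
      ... | inj₂ (inj₁ refl) = inj₂ (inj₁ refl)
      ... | inj₂ (inj₂ (inj₁ refl)) = inj₂ (inj₂ (inj₁ refl))
      ... | inj₂ (inj₂ (inj₂ refl)) = inj₂ (inj₂ (inj₂ refl))

  module _ {v p q r s : Fin n} (N : Neighbourhood v p q r s) where
    open Neighbourhood N

    swap-first : Neighbourhood v q p r s
    swap-first = record
      { vp = vq ; vq = vp ; vr = vr ; vs = vs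
      ; p≢q = p≢q ∘ sym ; p≢r = q≢r ; p≢s = q≢s ; q≢r = p≢r ; q≢s = p≢s ; r≢s = r≢s
      ; cover = λ vu → [ inj₂ ∘ inj₁ , [ inj₁ , inj₂ ∘ inj₂ ]′ ]′ (cover vu) }

    swap-pairs : Neighbourhood v r s p q
    swap-pairs = record
      { vp = vr ; vq = vs ; vr = vp ; vs = vq
      ; p≢q = r≢s ; p≢r = p≢r ∘ sym ; p≢s = q≢r ∘ sym
      ; q≢r = p≢s ∘ sym ; q≢s = q≢s ∘ sym ; r≢s = p≢q
      ; cover = λ vu →
          [ inj₂ ∘ inj₂ ∘ inj₁ , [ inj₂ ∘ inj₂ ∘ inj₂ , [ inj₁ , inj₂ ∘ inj₁ ]′ ]′ ]′ (cover vu) }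

module _ {n k : ℕ} (G : Graph n) {f : Fin n → Fin k} (star : IsStarColouring G f) where

  no-bicoloured-P₄ : ∀ {x y z w} → Adj G x y → Adj G y z → Adj G z w →
    f z ≡ f x → f w ≡ f y → x ≢ z → y ≢ w → ⊥
  no-bicoloured-P₄ {x} {y} {z} {w} xy yz zw fz≡fx fw≡fy x≢z y≢w
    with centre , _ , star-edge ← proj₂ star (f x) (f y) x (inj₁ refl)
    = spoke (star-edge x y rx ry xy) (star-edge y z ry rz yz) (star-edge z w rz rw zw)
    where
    rx = here (inj₁ refl)
    ry = step rx xy (inj₂ refl)
    rz = step ry yz (inj₁ fz≡fx)
    rw = step rz zw (inj₂ fw≡fy)
    spoke : x ≡ centre ⊎ y ≡ centre → y ≡ centre ⊎ z ≡ centre → z ≡ centre ⊎ w ≡ centre → ⊥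
    spoke (inj₁ refl) (inj₁ refl) _ = Adj-irrefl G xy refl
    spoke (inj₁ refl) (inj₂ refl) _ = x≢z refl
    spoke (inj₂ refl) (inj₁ _) (inj₁ refl) = Adj-irrefl G yz refl
    spoke (inj₂ refl) (inj₁ _) (inj₂ refl) = y≢w refl
    spoke (inj₂ refl) (inj₂ refl) _ = Adj-irrefl G yz refl

module _ {n : ℕ} (G : Graph n) (claw-free : ClawFree G) where

  claw-free-edge : ∀ {v a b c} → Adj G v a → Adj G v b → Adj G v c → a ≢ b → a ≢ c → b ≢ c →
    Adj G a b ⊎ Adj G a c ⊎ Adj G b c
  claw-free-edge {v} {a} {b} {c} va vb vc a≢b a≢c b≢c
    with adj G a b in ab | adj G a c in ac | adj G b c in bc
  ... | true | _ | _ = inj₁ refl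
  ... | false | true | _ = inj₂ (inj₁ refl)
  ... | false | false | true = inj₂ (inj₂ refl)
  ... | false | false | false =
    ⊥-elim (claw-free (v , a , b , c , va , vb , vc , a≢b , a≢c , b≢c , ab , ac , bc))

  claw-free-edge′ : ∀ {v a b c} → Adj G v a → Adj G v b → Adj G v c → a ≢ b → a ≢ c → b ≢ c →
    ¬ Adj G a b → Adj G a c ⊎ Adj G b c
  claw-free-edge′ va vb vc a≢b a≢c b≢c ¬ab =
    [ (λ ab → contradiction ab ¬ab) , id ]′ (claw-free-edge va vb vc a≢b a≢c b≢c)

module _ {n : ℕ} (G : Graph n) where

  degree≡∑ : ∀ v → degree G v ≡ ∑[ u < n ] (if adj G v u then 1 else 0)
  degree≡∑ v = trans (cong sum (map-tabulate {n = n} id (λ u → if adj G v u then 1 else 0)))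
    (sum-tabulate {n} _)

  tight-edge-weights : (w : Fin n → Fin n → ℕ) →
    (∀ {u v} → Adj G u v → 1 ≤ w u v + w v u) →
    (∀ u → ∑[ v < n ] w u v + ∑[ v < n ] w u v ≡ degree G u) →
    ∀ {u v} → Adj G u v → w u v + w v u ≡ 1
  tight-edge-weights w covers weight-sum {u} {v} uv = begin
    w u v + w v u  ≡⟨ ∑-≡∧≤⇒≗ (edge≤ u) (∑-≡∧≤⇒≗ (∑-mono-≤ ∘ edge≤) double-count u) v ⟨
    edge u v       ≡⟨ cong (λ b → if b then 1 else 0) uv ⟩
    1              ∎
    where
    open ≡-Reasoning
    edge : Fin n → Fin n → ℕ
    edge x y = if adj G x y then 1 else 0
    edge≤ : ∀ x y → edge x y ≤ w x y + w y x
    edge≤ x y with adj G x y in xy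
    ... | true = covers xy
    ... | false = z≤n
    double-count : ∑[ x < n ] ∑[ y < n ] edge x y ≡ ∑[ x < n ] ∑[ y < n ] (w x y + w y x)
    double-count = begin
      ∑[ x < n ] ∑[ y < n ] edge x y                   ≡⟨ sum-cong-≗ (λ x → trans (weight-sum x) (degree≡∑ x)) ⟨
      ∑[ x < n ] (∑[ y < n ] w x y + ∑[ y < n ] w x y) ≡⟨ ∑-distrib-+ row row ⟩
      ∑[ x < n ] row x + ∑[ x < n ] row x              ≡⟨ cong (∑[ x < n ] row x +_) (∑-comm w) ⟩
      ∑[ x < n ] row x + ∑[ x < n ] ∑[ y < n ] w y x   ≡⟨ ∑-distrib-+ row _ ⟨
      ∑[ x < n ] (∑[ y < n ] w x y + ∑[ y < n ] w y x) ≡⟨ sum-cong-≗ (λ x → ∑-distrib-+ (w x) _) ⟨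
      ∑[ x < n ] ∑[ y < n ] (w x y + w y x)            ∎
      where
      row : Fin n → ℕ
      row x = ∑[ y < n ] w x y

module _ {n : ℕ} (G : Graph n) (side : Fin n → Fin n → Bool)
  (side-sym : ∀ {u v} → Adj G u v → side u v ≡ side v u)
  (side-trans : ∀ {w u v} → Adj G w u → Adj G w v → u ≢ v → side w u ≡ side w v →
    Adj G u v × side u v ≡ side w u)
  where

  SameClique : Bool → Fin n → Fin n → Set
  SameClique s u v = u ≡ v ⊎ (Adj G u v × side u v ≡ s)

  same-clique? : ∀ s u → Decidable (SameClique s u)
  same-clique? s u v = (u ≟ᶠ v) ⊎-dec (Adj? G u v ×-dec (side u v ≟ᵇ s))

  same-clique-equivalence : ∀ s → IsEquivalence (SameClique s)
  same-clique-equivalence s = record { refl = inj₁ refl ; sym = symmetric ; trans = transitive }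
    where
    symmetric : ∀ {u v} → SameClique s u v → SameClique s v u
    symmetric (inj₁ u≡v) = inj₁ (sym u≡v)
    symmetric (inj₂ (uv , side≡s)) = inj₂ (Adj-sym G uv , trans (sym (side-sym uv)) side≡s)
    transitive : ∀ {u v w} → SameClique s u v → SameClique s v w → SameClique s u w
    transitive (inj₁ refl) vw = vw
    transitive uv (inj₁ refl) = uv
    transitive {u} {v} {w} (inj₂ (uv , uv≡s)) (inj₂ (vw , vw≡s)) with u ≟ᶠ w
    ... | yes u≡w = inj₁ u≡w
    ... | no u≢w
      with uw , uw≡vu ← side-trans (Adj-sym G uv) vw u≢w (trans (sym (side-sym uv)) (trans uv≡s (sym vw≡s)))
      = inj₂ (uw , trans uw≡vu (trans (sym (side-sym uv)) uv≡s))

  clique : Bool → Fin n → Fin n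
  clique s = Representative.representative (same-clique? s) (same-clique-equivalence s)

  clique-cong : ∀ {s u v} → SameClique s u v → clique s u ≡ clique s v
  clique-cong {s} = Representative.representative-cong (same-clique? s) (same-clique-equivalence s)

  clique-injective : ∀ {s u v} → clique s u ≡ clique s v → SameClique s u v
  clique-injective {s} = Representative.representative-injective (same-clique? s) (same-clique-equivalence s)

  -- Each clique of side false (true) becomes a vertex on the left (right) of H, named by its
  -- representative; a vertex of G becomes the edge joining its two cliques.
  left right : Fin n → Fin (n + n)
  left u = clique false u ↑ˡ n
  right u = n ↑ʳ clique true u

  part : Fin (n + n) → Bool
  part x = [ const false , const true ]′ (splitAt n x)

  part-left : ∀ u → part (left u) ≡ false
  part-left u rewrite splitAt-↑ˡ n (clique false u) n = refl

  part-right : ∀ u → part (right u) ≡ true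
  part-right u rewrite splitAt-↑ʳ n n (clique true u) = refl

  Joins : Fin n → Fin (n + n) → Fin (n + n) → Set
  Joins v x y = (left v ≡ x × right v ≡ y) ⊎ (left v ≡ y × right v ≡ x)

  joins? : ∀ v x y → Dec (Joins v x y)
  joins? v x y = (left v ≟ᶠ x ×-dec right v ≟ᶠ y) ⊎-dec (left v ≟ᶠ y ×-dec right v ≟ᶠ x)

  part-left≢part-right : ∀ u v → part (left u) ≢ part (right v)
  part-left≢part-right u v eq with () ← trans (sym (part-left u)) (trans eq (part-right v))

  left≢right : ∀ u v → left u ≢ right v
  left≢right u v = part-left≢part-right u v ∘ cong part

  H : Graph (n + n)
  H = record
    { adj = λ x y → does (any? λ v → joins? v x y)
    ; sym = λ x y →
        does-⇔ (mk⇔ (map₂ swap) (map₂ swap)) (any? λ v → joins? v x y) (any? λ v → joins? v y x)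
    ; irrefl = λ x → dec-false (any? λ v → joins? v x x) λ where
        (v , inj₁ (refl , eq)) → left≢right v v (sym eq)
        (v , inj₂ (refl , eq)) → left≢right v v (sym eq) }

  joined : ∀ {x y} → Adj H x y → ∃ λ v → Joins v x y
  joined {x} {y} xy with any? (λ v → joins? v x y)
  ... | yes joining = joining

  line-graph : IsLineGraphOfBipartite G
  line-graph = n + n , H , part , bipartite , (λ v → left v , right v) ,
    (λ v → dec-true (any? λ w → joins? w (left v) (right v)) (v , inj₁ (refl , refl)) ,
           part-left v , part-right v) ,
    injective , surjective , adjacency
    where
    bipartite : ∀ x y → Adj H x y → part x ≢ part y
    bipartite x y xy with joined xy
    ... | v , inj₁ (refl , refl) = part-left≢part-right v v
    ... | v , inj₂ (refl , refl) = part-left≢part-right v v ∘ sym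
    injective : Injective _≡_ _≡_ (λ v → left v , right v)
    injective eq with clique-injective (↑ˡ-injective n _ _ (cong proj₁ eq))
                    | clique-injective (↑ʳ-injective n _ _ (cong proj₂ eq))
    ... | inj₁ u≡v | _ = u≡v
    ... | inj₂ _ | inj₁ u≡v = u≡v
    ... | inj₂ (_ , side≡false) | inj₂ (_ , side≡true) with () ← trans (sym side≡true) side≡false
    surjective : ∀ x y → Adj H x y → part x ≡ false → ∃ λ v → (left v , right v) ≡ (x , y)
    surjective x y xy part-x with joined xy
    ... | v , inj₁ (refl , refl) = v , refl
    ... | v , inj₂ (refl , refl) with () ← trans (sym (part-right v)) part-x
    adjacency : ∀ u v → u ≢ v →
      (Adj G u v → left u ≡ left v ⊎ right u ≡ right v) × (left u ≡ left v ⊎ right u ≡ right v → Adj G u v)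
    adjacency u v u≢v = share , adjacent
      where
      share : Adj G u v → left u ≡ left v ⊎ right u ≡ right v
      share uv with side u v in side-uv
      ... | false = inj₁ (cong (_↑ˡ n) (clique-cong (inj₂ (uv , side-uv))))
      ... | true = inj₂ (cong (n ↑ʳ_) (clique-cong (inj₂ (uv , side-uv))))
      adjacent-in-clique : ∀ {s} → SameClique s u v → Adj G u v
      adjacent-in-clique (inj₁ u≡v) = ⊥-elim (u≢v u≡v)
      adjacent-in-clique (inj₂ (uv , _)) = uv
      adjacent : left u ≡ left v ⊎ right u ≡ right v → Adj G u v
      adjacent (inj₁ eq) = adjacent-in-clique (clique-injective (↑ˡ-injective n _ _ eq))
      adjacent (inj₂ eq) = adjacent-in-clique (clique-injective (↑ʳ-injective n _ _ eq))

clamp : ∀ K → ℕ → Fin (suc K)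
clamp zero _ = Fin.zero
clamp (suc K) zero = Fin.zero
clamp (suc K) (suc i) = Fin.suc (clamp K i)

toℕ-clamp : ∀ {K i} → i ≤ K → toℕ (clamp K i) ≡ i
toℕ-clamp {zero} z≤n = refl
toℕ-clamp {suc K} z≤n = refl
toℕ-clamp {suc K} (s≤s i≤K) = cong suc (toℕ-clamp i≤K)

alternating-parity : (t : ℕ → Bool) → ∀ N → (∀ i → i ≤ N + N → t (suc i) ≡ not (t i)) →
  t (suc (N + N)) ≡ not (t 0)
alternating-parity t zero alternates = alternates 0 z≤n
alternating-parity t (suc N) alternates rewrite +-suc N N = begin
  t (3 + (N + N))        ≡⟨ alternates (2 + (N + N)) ≤-refl ⟩
  not (t (2 + (N + N)))  ≡⟨ cong not (alternates (suc (N + N)) (n≤1+n _)) ⟩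
  not (not (t (suc (N + N)))) ≡⟨ not-involutive _ ⟩
  t (suc (N + N))        ≡⟨ alternating-parity t N (λ i i≤ → alternates i (m≤n⇒m≤1+n (m≤n⇒m≤1+n i≤))) ⟩
  not (t 0)              ∎
  where open ≡-Reasoning

module CycleWalk {n K : ℕ} (G : Graph n) (c : Fin (suc K) → Fin n) (c-injective : Injective _≡_ _≡_ c)
  (cycle : ∀ i j → (Adj G (c i) (c j) → CycAdj (suc K) i j) × (CycAdj (suc K) i j → Adj G (c i) (c j))) where

  x : ℕ → Fin n
  x i = c (clamp K i)

  walk-edge : ∀ i → i < K → Adj G (x i) (x (suc i))
  walk-edge i i<K = proj₂ (cycle (clamp K i) (clamp K (suc i)))
    (inj₁ (trans (cong suc (toℕ-clamp (<⇒≤ i<K))) (sym (toℕ-clamp i<K))))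

  wrap : Adj G (x K) (x 0)
  wrap = proj₂ (cycle (clamp K K) (clamp K 0))
    (inj₂ (inj₂ (inj₂ (toℕ-clamp z≤n , cong suc (toℕ-clamp ≤-refl)))))

  Consecutive : ℕ → ℕ → Set
  Consecutive p q = suc p ≡ q ⊎ suc q ≡ p ⊎ (p ≡ 0 × suc q ≡ suc K) ⊎ (q ≡ 0 × suc p ≡ suc K)

  walk-non-adjacent : ∀ {p q} → p ≤ K → q ≤ K → ¬ Consecutive p q → ¬ Adj G (x p) (x q)
  walk-non-adjacent {p} {q} p≤K q≤K ¬cyc xpq with proj₁ (cycle (clamp K p) (clamp K q)) xpq
  ... | cyc rewrite toℕ-clamp p≤K | toℕ-clamp q≤K = ¬cyc cyc

  walk-distinct : ∀ {p q} → p ≤ K → q ≤ K → p ≢ q → x p ≢ x q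
  walk-distinct p≤K q≤K p≢q xp≡xq =
    p≢q (trans (sym (toℕ-clamp p≤K)) (trans (cong toℕ (c-injective xp≡xq)) (toℕ-clamp q≤K)))

SharesEnd : ∀ {m} → Fin m × Fin m → Fin m × Fin m → Set
SharesEnd (a , b) (c , d) = a ≡ c ⊎ b ≡ d

module _ {n m : ℕ} (G : Graph n) (e : Fin n → Fin m × Fin m)
  (shares-end : ∀ u v → u ≢ v →
    (Adj G u v → SharesEnd (e u) (e v)) × (SharesEnd (e u) (e v) → Adj G u v))
  where

  shares-left : Fin n → Fin n → Bool
  shares-left u v = does (proj₁ (e u) ≟ᶠ proj₁ (e v))

  shared-end-alternates : ∀ {u v w} → Adj G u v → Adj G v w → ¬ Adj G u w → u ≢ w →
    shares-left v w ≡ not (shares-left u v)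
  shared-end-alternates {u} {v} {w} uv vw ¬uw u≢w =
    ¬-not (λ same → ¬uw (proj₂ (shares-end u w u≢w) (shared same)))
    where
    right-if-not-left : ∀ {x y} → Adj G x y → ¬ (proj₁ (e x) ≡ proj₁ (e y)) → proj₂ (e x) ≡ proj₂ (e y)
    right-if-not-left {x} {y} xy ¬left =
      [ (λ left → ⊥-elim (¬left left)) , id ]′ (proj₁ (shares-end x y (Adj-irrefl G xy)) xy)
    shared : shares-left v w ≡ shares-left u v → proj₁ (e u) ≡ proj₁ (e w) ⊎ proj₂ (e u) ≡ proj₂ (e w)
    shared same with proj₁ (e u) ≟ᶠ proj₁ (e v) | proj₁ (e v) ≟ᶠ proj₁ (e w) | same
    ... | yes uv-left | yes vw-left | _ = inj₁ (trans uv-left vw-left)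
    ... | no ¬uv-left | no ¬vw-left | _ =
      inj₂ (trans (right-if-not-left uv ¬uv-left) (right-if-not-left vw ¬vw-left))
    ... | yes _ | no _ | ()
    ... | no _ | yes _ | ()

  module _ (j : ℕ) where
    private
      N = suc j
      K = suc (suc (N + N))

    no-induced-odd-cycle : ¬ InducedCycle G (suc K)
    no-induced-odd-cycle (c , c-injective , cycle) = not-fixed (begin
      t 0                           ≡⟨ shared-end-alternates wrap (walk-edge 0 (s≤s z≤n))
                                         (walk-non-adjacent ≤-refl (s≤s z≤n) wrap-chord₂)
                                         (walk-distinct ≤-refl (s≤s z≤n) λ ()) ⟩
      not (shares-left (x K) (x 0)) ≡⟨ cong not (shared-end-alternates (walk-edge (suc (N + N)) ≤-refl) wrap
                                         (walk-non-adjacent (n≤1+n _) z≤n wrap-chord₁)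
                                         (walk-distinct (n≤1+n _) z≤n λ ())) ⟩
      not (not (t (suc (N + N))))   ≡⟨ not-involutive _ ⟩
      t (suc (N + N))               ≡⟨ alternating-parity t N alternates ⟩
      not (t 0)                     ∎)
      where
      open ≡-Reasoning
      open CycleWalk G c c-injective cycle
      t : ℕ → Bool
      t i = shares-left (x i) (x (suc i))
      wrap-chord₁ : ¬ Consecutive (suc (N + N)) 0
      wrap-chord₁ (inj₂ (inj₂ (inj₂ (_ , eq)))) = 1+n≢n (sym eq)
      wrap-chord₂ : ¬ Consecutive K 1
      wrap-chord₂ (inj₁ ())
      wrap-chord₂ (inj₂ (inj₁ ()))
      wrap-chord₂ (inj₂ (inj₂ (inj₁ (() , _))))
      wrap-chord₂ (inj₂ (inj₂ (inj₂ (() , _))))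
      skip-chord : ∀ i → ¬ Consecutive i (suc (suc i))
      skip-chord i (inj₁ eq) = 1+n≢n (sym eq)
      skip-chord i (inj₂ (inj₁ eq)) = m≢1+n+m i {2} (sym eq)
      skip-chord .0 (inj₂ (inj₂ (inj₁ (refl , ()))))
      alternates : ∀ i → i ≤ N + N → t (suc i) ≡ not (t i)
      alternates i i≤N+N = shared-end-alternates (walk-edge i (s≤s i≤1+N+N)) (walk-edge (suc i) (s≤s (s≤s i≤N+N)))
        (walk-non-adjacent i≤K (s≤s (s≤s i≤N+N)) (skip-chord i))
        (walk-distinct i≤K (s≤s (s≤s i≤N+N)) (m≢1+n+m i {1}))
        where
        i≤1+N+N = m≤n⇒m≤1+n i≤N+N
        i≤K = m≤n⇒m≤1+n i≤1+N+N
      not-fixed : ∀ {b} → b ≢ not b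
      not-fixed {true} ()
      not-fixed {false} ()

line-graph-of-bipartite⇒odd-hole-free : ∀ {n} (G : Graph n) → IsLineGraphOfBipartite G → OddHoleFree G
line-graph-of-bipartite⇒odd-hole-free G (_ , _ , _ , _ , e , _ , _ , _ , shares-end) (suc j) _ hole =
  no-induced-odd-cycle G e shares-end j (subst (InducedCycle G) length≡ hole)
  where
  length≡ : 2 * suc j + 3 ≡ 3 + (suc j + suc j)
  length≡ = trans (+-comm (2 * suc j) 3) (cong (λ m → 3 + (suc j + m)) (+-identityʳ (suc j)))

module ClawFreeQuarticStarColouring {n : ℕ} (G : Graph n) (claw-free : ClawFree G) (regular : Regular 4 G)
  {f : Fin n → Fin 4} (star : IsStarColouring G f) where

  colour-≢ : ∀ {u v} → Adj G u v → f u ≢ f v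
  colour-≢ {u} {v} = proj₁ star u v

  same-colour⇒¬Adj : ∀ {u v} → f u ≡ f v → ¬ Adj G u v
  same-colour⇒¬Adj fu≡fv uv = colour-≢ uv fu≡fv

  no-monochromatic-triple : ∀ {v p q r} → Adj G v p → Adj G v q → Adj G v r → p ≢ q → p ≢ r → q ≢ r →
    f p ≡ f q → f p ≡ f r → ⊥
  no-monochromatic-triple vp vq vr p≢q p≢r q≢r fp≡fq fp≡fr
    with claw-free-edge G claw-free vp vq vr p≢q p≢r q≢r
  ... | inj₁ pq = same-colour⇒¬Adj fp≡fq pq
  ... | inj₂ (inj₁ pr) = same-colour⇒¬Adj fp≡fr pr
  ... | inj₂ (inj₂ qr) = same-colour⇒¬Adj (trans (sym fp≡fq) fp≡fr) qr

  some-neighbours-share-colour : ∀ v → ∃₂ λ p q → Adj G v p × Adj G v q × p ≢ q × f p ≡ f q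
  some-neighbours-share-colour v with pigeonhole (s≤s (s≤s (s≤s (s≤s (s≤s z≤n))))) colours
    where
    colours : Fin 5 → Fin 4
    colours Fin.zero = f v
    colours (Fin.suc i) = f (neighbour G regular v i)
  ... | Fin.zero , Fin.suc j , _ , fv≡fu = ⊥-elim (colour-≢ (neighbour-adj G regular v j) fv≡fu)
  ... | Fin.suc i , Fin.suc j , s≤s i<j , fu≡fw =
    neighbour G regular v i , neighbour G regular v j , neighbour-adj G regular v i , neighbour-adj G regular v j ,
    <⇒≢ i<j ∘ neighbour-injective G regular v , fu≡fw

  module _ {v p q r s : Fin n} (N : Neighbourhood G v p q r s) (fp≡fq : f p ≡ f q) where
    open Neighbourhood N

    -- The neighbours x, y of p besides v and r are not adjacent to v, so claw-freeness at p joins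
    -- them; neither has colour f v (else q v p x or q v p y would be a bicoloured P₄), so
    -- f v, f p, f r, f x, f y cannot all differ.
    other-neighbour-of-colour : f p ≢ f r → Adj G p r → ¬ Adj G p s → ∃ λ x → x ≢ r × Adj G p x × f x ≡ f r
    other-neighbour-of-colour fp≢fr pr ¬ps
      with x , y , Np ← neighbourhood G regular p (Adj-sym G vp) pr (Adj-irrefl G vr)
      with f x ≟ᶠ f r | f y ≟ᶠ f r
    ... | yes fx≡fr | _ = x , Neighbourhood.q≢r Np ∘ sym , Neighbourhood.vr Np , fx≡fr
    ... | no _ | yes fy≡fr = y , Neighbourhood.q≢s Np ∘ sym , Neighbourhood.vs Np , fy≡fr
    ... | no fx≢fr | no fy≢fr = ⊥-elim (no-five-distinct (f v) (f p) (f r) (f x) (f y)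
      (colour-≢ vp) (colour-≢ vr) (fv≢ px v≢x) (fv≢ py v≢y) fp≢fr (colour-≢ px) (colour-≢ py)
      (fx≢fr ∘ sym) (fy≢fr ∘ sym) (colour-≢ xy))
      where
      open Neighbourhood Np using ()
        renaming (vr to px; vs to py; p≢r to v≢x; p≢s to v≢y; q≢r to r≢x; q≢s to r≢y; r≢s to x≢y)
      ¬Adj-v : ∀ {z} → Adj G p z → z ≢ r → ¬ Adj G v z
      ¬Adj-v {z} pz z≢r vz with cover vz
      ... | inj₁ refl = Adj-irrefl G pz refl
      ... | inj₂ (inj₁ refl) = same-colour⇒¬Adj fp≡fq pz
      ... | inj₂ (inj₂ (inj₁ z≡r)) = z≢r z≡r
      ... | inj₂ (inj₂ (inj₂ refl)) = ¬ps pz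
      xy : Adj G x y
      xy with claw-free-edge G claw-free (Adj-sym G vp) px py v≢x v≢y x≢y
      ... | inj₁ vx = ⊥-elim (¬Adj-v px (r≢x ∘ sym) vx)
      ... | inj₂ (inj₁ vy) = ⊥-elim (¬Adj-v py (r≢y ∘ sym) vy)
      ... | inj₂ (inj₂ xy) = xy
      fv≢ : ∀ {z} → Adj G p z → v ≢ z → f v ≢ f z
      fv≢ pz v≢z fv≡fz = no-bicoloured-P₄ G star (Adj-sym G vq) vp pz fp≡fq (sym fv≡fz) (p≢q ∘ sym) v≢z

  module _ {v p q r s : Fin n} (N : Neighbourhood G v p q r s) (fp≡fq : f p ≡ f q) where
    open Neighbourhood N

    no-double-cross : f r ≡ f s → Adj G p r → Adj G p s → ⊥
    no-double-cross fr≡fs pr ps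
      with claw-free-edge′ G claw-free vr vs vq r≢s (q≢r ∘ sym) (q≢s ∘ sym) (same-colour⇒¬Adj fr≡fs)
    ... | inj₁ rq = no-bicoloured-P₄ G star (Adj-sym G ps) pr rq fr≡fs (sym fp≡fq) (r≢s ∘ sym) p≢q
    ... | inj₂ sq = no-bicoloured-P₄ G star (Adj-sym G pr) ps sq (sym fr≡fs) (sym fp≡fq) r≢s p≢q

    no-cross-matching : f r ≡ f s → f p ≢ f r → Adj G p r → ¬ Adj G p s → ¬ Adj G q r → ⊥
    no-cross-matching fr≡fs fp≢fr pr ¬ps ¬qr
      with x , x≢r , px , fx≡fr ← other-neighbour-of-colour N fp≡fq fp≢fr pr ¬ps
         | z , z≢p , rz , fz≡fp ← other-neighbour-of-colour (swap-pairs G N) fr≡fs (fp≢fr ∘ sym)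
                                     (Adj-sym G pr) (¬qr ∘ Adj-sym G)
      = no-bicoloured-P₄ G star (Adj-sym G px) pr rz (sym fx≡fr) fz≡fp x≢r (z≢p ∘ sym)

  module _ {v p q r s : Fin n} (N : Neighbourhood G v p q r s) where
    open Neighbourhood N

    -- By claw-freeness at v, each of r, s has a neighbour in {p, q}; no vertex of one pair sees
    -- both vertices of the other, so these edges would form a perfect matching between the pairs.
    no-two-colour-pairs : f p ≡ f q → f r ≡ f s → ⊥
    no-two-colour-pairs fp≡fq fr≡fs
      with claw-free-edge′ G claw-free vp vq vr p≢q p≢r q≢r (same-colour⇒¬Adj fp≡fq)
         | claw-free-edge′ G claw-free vp vq vs p≢q p≢s q≢s (same-colour⇒¬Adj fp≡fq)
    ... | inj₁ pr | inj₁ ps = no-double-cross N fp≡fq fr≡fs pr ps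
    ... | inj₂ qr | inj₂ qs = no-double-cross (swap-first G N) (sym fp≡fq) fr≡fs qr qs
    ... | inj₁ pr | inj₂ qs = no-cross-matching N fp≡fq fr≡fs fp≢fr pr
      (no-double-cross N fp≡fq fr≡fs pr) (λ qr → no-double-cross (swap-first G N) (sym fp≡fq) fr≡fs qr qs)
      where
      fp≢fr : f p ≢ f r
      fp≢fr = no-monochromatic-triple vp vq vr p≢q p≢r q≢r fp≡fq
    ... | inj₂ qr | inj₁ ps = no-cross-matching (swap-first G N) (sym fp≡fq) fr≡fs fq≢fr qr
      (no-double-cross (swap-first G N) (sym fp≡fq) fr≡fs qr) (λ pr → no-double-cross N fp≡fq fr≡fs pr ps)
      where
      fq≢fr : f q ≢ f r
      fq≢fr fq≡fr = no-monochromatic-triple vp vq vr p≢q p≢r q≢r fp≡fq (trans fp≡fq fq≡fr)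

  record Pattern (v : Fin n) : Set where
    field
      a a′ b c : Fin n
      nbhd : Neighbourhood G v a a′ b c
      fa≡fa′ : f a ≡ f a′
      fa≢fb : f a ≢ f b
      fa≢fc : f a ≢ f c
      fb≢fc : f b ≢ f c

  abstract
    colour-pattern : ∀ v → Pattern v
    colour-pattern v
      with p , q , vp , vq , p≢q , fp≡fq ← some-neighbours-share-colour v
      with r , s , N ← neighbourhood G regular v vp vq p≢q
      = record
        { nbhd = N ; fa≡fa′ = fp≡fq
        ; fa≢fb = no-monochromatic-triple vp vq vr p≢q p≢r q≢r fp≡fq
        ; fa≢fc = no-monochromatic-triple vp vq vs p≢q p≢s q≢s fp≡fq
        ; fb≢fc = no-two-colour-pairs N fp≡fq }
      where open Neighbourhood N hiding (vp; vq; p≢q)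

  module Pat (v : Fin n) = Pattern (colour-pattern v)
  open Pat using (a; a′; b; c)

  Heavy Light : Fin n → Fin n → Set
  Heavy v u = u ≡ a v ⊎ u ≡ a′ v
  Light v u = u ≡ b v ⊎ u ≡ c v

  heavy-or-light : ∀ {v u} → Adj G v u → Heavy v u ⊎ Light v u
  heavy-or-light {v} vu with Neighbourhood.cover (Pat.nbhd v) vu
  ... | inj₁ u≡a = inj₁ (inj₁ u≡a)
  ... | inj₂ (inj₁ u≡a′) = inj₁ (inj₂ u≡a′)
  ... | inj₂ (inj₂ (inj₁ u≡b)) = inj₂ (inj₁ u≡b)
  ... | inj₂ (inj₂ (inj₂ u≡c)) = inj₂ (inj₂ u≡c)

  heavy-colour : ∀ {v u} → Heavy v u → f u ≡ f (a v)
  heavy-colour (inj₁ refl) = refl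
  heavy-colour {v} (inj₂ refl) = sym (Pat.fa≡fa′ v)

  light-colour : ∀ {v u} → Light v u → f u ≢ f (a v)
  light-colour {v} (inj₁ refl) = Pat.fa≢fb v ∘ sym
  light-colour {v} (inj₂ refl) = Pat.fa≢fc v ∘ sym

  heavy-adj : ∀ {v u} → Heavy v u → Adj G v u
  heavy-adj {v} (inj₁ refl) = Neighbourhood.vp (Pat.nbhd v)
  heavy-adj {v} (inj₂ refl) = Neighbourhood.vq (Pat.nbhd v)

  light-adj : ∀ {v u} → Light v u → Adj G v u
  light-adj {v} (inj₁ refl) = Neighbourhood.vr (Pat.nbhd v)
  light-adj {v} (inj₂ refl) = Neighbourhood.vs (Pat.nbhd v)

  other-heavy : ∀ {v u} → Heavy v u → ∃ λ u′ → Adj G v u′ × u′ ≢ u × f u′ ≡ f u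
  other-heavy {v} (inj₁ refl) =
    a′ v , heavy-adj (inj₂ refl) , Neighbourhood.p≢q (Pat.nbhd v) ∘ sym , sym (Pat.fa≡fa′ v)
  other-heavy {v} (inj₂ refl) = a v , heavy-adj (inj₁ refl) , Neighbourhood.p≢q (Pat.nbhd v) , Pat.fa≡fa′ v

  not-heavy-both-ways : ∀ {v u} → Heavy v u → Heavy u v → ⊥
  not-heavy-both-ways vu uv
    with u′ , vu′ , u′≢u , fu′≡fu ← other-heavy vu | v′ , uv′ , v′≢v , fv′≡fv ← other-heavy uv
    = no-bicoloured-P₄ G star (Adj-sym G vu′) (heavy-adj vu) uv′ (sym fu′≡fu) fv′≡fv u′≢u (v′≢v ∘ sym)

  lightness : Fin n → Fin n → ℕ
  lightness v u = indicator (b v) u + indicator (c v) u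

  b≢c : ∀ v → b v ≢ c v
  b≢c v = Pat.fb≢fc v ∘ cong f

  light⇒lightness≡1 : ∀ {v u} → Light v u → lightness v u ≡ 1
  light⇒lightness≡1 {v} (inj₁ refl)
    rewrite dec-true (b v ≟ᶠ b v) refl | dec-false (b v ≟ᶠ c v) (b≢c v) = refl
  light⇒lightness≡1 {v} (inj₂ refl)
    rewrite dec-false (c v ≟ᶠ b v) (b≢c v ∘ sym) | dec-true (c v ≟ᶠ c v) refl = refl

  one-light-end : ∀ {v u} → Adj G v u → lightness v u + lightness u v ≡ 1
  one-light-end = tight-edge-weights G lightness some-light-end two-light-neighbours
    where
    some-light-end : ∀ {v u} → Adj G v u → 1 ≤ lightness v u + lightness u v
    some-light-end {v} {u} vu with heavy-or-light vu | heavy-or-light (Adj-sym G vu)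
    ... | inj₂ light | _ =
      subst (_≤ lightness v u + lightness u v) (light⇒lightness≡1 light) (m≤m+n (lightness v u) (lightness u v))
    ... | inj₁ _ | inj₂ light =
      subst (_≤ lightness v u + lightness u v) (light⇒lightness≡1 light) (m≤n+m (lightness u v) (lightness v u))
    ... | inj₁ heavy | inj₁ heavy′ = ⊥-elim (not-heavy-both-ways heavy heavy′)
    two-light-neighbours : ∀ v → ∑[ u < n ] lightness v u + ∑[ u < n ] lightness v u ≡ degree G v
    two-light-neighbours v = begin
      ∑[ u < n ] lightness v u + ∑[ u < n ] lightness v u ≡⟨ cong₂ _+_ two two ⟩
      4                                                   ≡⟨ regular v ⟨
      degree G v                                          ∎
      where
      open ≡-Reasoning
      two : ∑[ u < n ] lightness v u ≡ 2
      two = trans (∑-distrib-+ (indicator (b v)) (indicator (c v)))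
        (cong₂ _+_ (∑-indicator (b v)) (∑-indicator (c v)))

  light⇒heavy : ∀ {v u} → Adj G v u → Light v u → Heavy u v
  light⇒heavy {v} {u} vu light with heavy-or-light (Adj-sym G vu)
  ... | inj₁ heavy = heavy
  ... | inj₂ light′ = ⊥-elim (1+n≢n (begin
    1 + 1                             ≡⟨ cong₂ _+_ (light⇒lightness≡1 light) (light⇒lightness≡1 light′) ⟨
    lightness v u + lightness u v     ≡⟨ one-light-end vu ⟩
    1                                 ∎))
    where open ≡-Reasoning

  heavy⇒light : ∀ {v u} → Adj G v u → Heavy v u → Light u v
  heavy⇒light vu heavy with heavy-or-light (Adj-sym G vu)
  ... | inj₁ heavy′ = ⊥-elim (not-heavy-both-ways heavy heavy′)
  ... | inj₂ light = light

  light-if-colour-differs : ∀ {v u} → Adj G v u → f u ≢ f (a v) → Light v u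
  light-if-colour-differs vu fu≢fa with heavy-or-light vu
  ... | inj₁ heavy = ⊥-elim (fu≢fa (heavy-colour heavy))
  ... | inj₂ light = light

  heavy-colour-of-light : ∀ {v u} → Light v u → f (a u) ≡ f v
  heavy-colour-of-light light = sym (heavy-colour (light⇒heavy (light-adj light) light))

  same-coloured-neighbours-are-heavy : ∀ {w p q} → Adj G w p → Adj G w q → p ≢ q → f p ≡ f q → Heavy w p
  same-coloured-neighbours-are-heavy {w} wp wq p≢q fp≡fq with heavy-or-light wp | heavy-or-light wq
  ... | inj₁ heavy | _ = heavy
  ... | inj₂ light | inj₁ heavy = ⊥-elim (light-colour light (trans fp≡fq (heavy-colour heavy)))
  ... | inj₂ (inj₁ refl) | inj₂ (inj₁ refl) = ⊥-elim (p≢q refl)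
  ... | inj₂ (inj₁ refl) | inj₂ (inj₂ refl) = ⊥-elim (Pat.fb≢fc w fp≡fq)
  ... | inj₂ (inj₂ refl) | inj₂ (inj₁ refl) = ⊥-elim (Pat.fb≢fc w (sym fp≡fq))
  ... | inj₂ (inj₂ refl) | inj₂ (inj₂ refl) = ⊥-elim (p≢q refl)

  record TwoTriangles (v : Fin n) : Set where
    field
      α α′ : Fin n
      heavy-pair : (α ≡ a v × α′ ≡ a′ v) ⊎ (α ≡ a′ v × α′ ≡ a v)
      α~b : Adj G α (b v)
      α′~c : Adj G α′ (c v)
      α≁c : ¬ Adj G α (c v)
      α′≁b : ¬ Adj G α′ (b v)

  module _ (v : Fin n) where
    private
      open Neighbourhood (Pat.nbhd v) using (vp; vq; p≢q; p≢r; p≢s; q≢r; q≢s) renaming (vr to vb; vs to vc)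
      b≢a = p≢r ∘ sym
      b≢a′ = q≢r ∘ sym
      c≢a = p≢s ∘ sym
      c≢a′ = q≢s ∘ sym
      heavy-claw : ∀ {x} → Adj G v x → x ≢ a v → x ≢ a′ v → Adj G (a v) x ⊎ Adj G (a′ v) x
      heavy-claw vx x≢a x≢a′ = claw-free-edge′ G claw-free vp vq vx p≢q (x≢a ∘ sym) (x≢a′ ∘ sym)
        (same-colour⇒¬Adj (Pat.fa≡fa′ v))
      b-adjacent-to-both-heavy : Adj G (a v) (b v) → Adj G (a′ v) (b v) → ⊥
      b-adjacent-to-both-heavy ab a′b = colour-≢ vp (sym (trans
        (heavy-colour (same-coloured-neighbours-are-heavy (Adj-sym G ab) (Adj-sym G a′b) p≢q (Pat.fa≡fa′ v)))
        (heavy-colour-of-light (inj₁ refl))))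
      adjacent-to-both-light : ∀ {x} → Heavy v x → Adj G x (b v) → Adj G x (c v) → ⊥
      adjacent-to-both-light {x} heavy xb xc =
        Pat.fb≢fc v (trans (heavy-colour (sees xb (inj₁ refl))) (sym (heavy-colour (sees xc (inj₂ refl)))))
        where
        sees : ∀ {u} → Adj G x u → Light v u → Heavy x u
        sees xy light = light⇒heavy (Adj-sym G xy) (light-if-colour-differs (Adj-sym G xy) λ fx≡ →
          colour-≢ (heavy-adj heavy) (sym (trans fx≡ (heavy-colour-of-light light))))

    two-triangles : TwoTriangles v
    two-triangles with Adj? G (a v) (b v)
    ... | yes ab = record
      { α = a v ; α′ = a′ v ; heavy-pair = inj₁ (refl , refl) ; α~b = ab
      ; α′~c = [ (λ ac → ⊥-elim (adjacent-to-both-light (inj₁ refl) ab ac)) , id ]′ (heavy-claw vc c≢a c≢a′)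
      ; α≁c = adjacent-to-both-light (inj₁ refl) ab
      ; α′≁b = λ a′b → b-adjacent-to-both-heavy ab a′b }
    ... | no ¬ab = record
      { α = a′ v ; α′ = a v ; heavy-pair = inj₂ (refl , refl) ; α~b = a′b
      ; α′~c = [ id , (λ a′c → ⊥-elim (adjacent-to-both-light (inj₂ refl) a′b a′c)) ]′ (heavy-claw vc c≢a c≢a′)
      ; α≁c = adjacent-to-both-light (inj₂ refl) a′b
      ; α′≁b = ¬ab }
      where
      a′b : Adj G (a′ v) (b v)
      a′b = [ (λ ab → ⊥-elim (¬ab ab)) , id ]′ (heavy-claw vb b≢a b≢a′)

  module Tri (v : Fin n) = TwoTriangles (two-triangles v)
  open Tri using (α; α′)

  α-heavy : ∀ v → Heavy v (α v)
  α-heavy v with Tri.heavy-pair v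
  ... | inj₁ (α≡a , _) = inj₁ α≡a
  ... | inj₂ (α≡a′ , _) = inj₂ α≡a′

  α′-heavy : ∀ v → Heavy v (α′ v)
  α′-heavy v with Tri.heavy-pair v
  ... | inj₁ (_ , α′≡a′) = inj₂ α′≡a′
  ... | inj₂ (_ , α′≡a) = inj₁ α′≡a

  heavy⇒α⊎α′ : ∀ {v u} → Heavy v u → u ≡ α v ⊎ u ≡ α′ v
  heavy⇒α⊎α′ {v} heavy with Tri.heavy-pair v | heavy
  ... | inj₁ (α≡a , _) | inj₁ refl = inj₁ (sym α≡a)
  ... | inj₁ (_ , α′≡a′) | inj₂ refl = inj₂ (sym α′≡a′)
  ... | inj₂ (_ , α′≡a) | inj₁ refl = inj₂ (sym α′≡a)
  ... | inj₂ (α≡a′ , _) | inj₂ refl = inj₁ (sym α≡a′)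

  First Second : Fin n → Fin n → Set
  First v u = u ≡ α v ⊎ u ≡ b v
  Second v u = u ≡ α′ v ⊎ u ≡ c v

  first-or-second : ∀ {v u} → Adj G v u → First v u ⊎ Second v u
  first-or-second vu with heavy-or-light vu
  ... | inj₁ heavy = [ inj₁ ∘ inj₁ , inj₂ ∘ inj₁ ]′ (heavy⇒α⊎α′ heavy)
  ... | inj₂ light = [ inj₁ ∘ inj₂ , inj₂ ∘ inj₂ ]′ light

  α≢α′ : ∀ v → α v ≢ α′ v
  α≢α′ v with Tri.heavy-pair v
  ... | inj₁ (α≡a , α′≡a′) = λ α≡α′ → a≢a′ (trans (sym α≡a) (trans α≡α′ α′≡a′))
    where a≢a′ = Neighbourhood.p≢q (Pat.nbhd v)
  ... | inj₂ (α≡a′ , α′≡a) = λ α≡α′ → a≢a′ (trans (sym α′≡a) (trans (sym α≡α′) α≡a′))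
    where a≢a′ = Neighbourhood.p≢q (Pat.nbhd v)

  ¬first-and-second : ∀ {v u} → First v u → Second v u → ⊥
  ¬first-and-second {v} (inj₁ u≡α) (inj₁ u≡α′) = α≢α′ v (trans (sym u≡α) u≡α′)
  ¬first-and-second {v} (inj₁ u≡α) (inj₂ u≡c) =
    light-colour (inj₂ refl) (trans (cong f (trans (sym u≡c) u≡α)) (heavy-colour (α-heavy v)))
  ¬first-and-second {v} (inj₂ u≡b) (inj₁ u≡α′) =
    light-colour (inj₁ refl) (trans (cong f (trans (sym u≡b) u≡α′)) (heavy-colour (α′-heavy v)))
  ¬first-and-second {v} (inj₂ u≡b) (inj₂ u≡c) = b≢c v (trans (sym u≡b) u≡c)

  first? : ∀ v u → Dec (First v u)
  first? v u = (u ≟ᶠ α v) ⊎-dec (u ≟ᶠ b v)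

  σ₁ σ₂ : Fin n → Bool
  σ₁ v = orientation (f v) (f (α v)) (f (b v))
  σ₂ v = orientation (f v) (f (α′ v)) (f (c v))

  side : Fin n → Fin n → Bool
  side v u = if does (first? v u) then σ₁ v else σ₂ v

  side-first : ∀ {v u} → First v u → side v u ≡ σ₁ v
  side-first {v} {u} first rewrite dec-true (first? v u) first = refl

  side-second : ∀ {v u} → Second v u → side v u ≡ σ₂ v
  side-second {v} {u} second rewrite dec-false (first? v u) (λ first → ¬first-and-second first second) = refl

  σ₁≢σ₂ : ∀ v → σ₁ v ≢ σ₂ v
  σ₁≢σ₂ v σ₁≡σ₂ = orientation-swap (f v) (f (α v)) (f (b v)) (f (c v))
    (colour-≢ (heavy-adj (α-heavy v)))
    (colour-≢ (light-adj {v} (inj₁ refl)))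
    (colour-≢ (light-adj {v} (inj₂ refl)))
    (λ fα≡fb → light-colour {v} (inj₁ refl) (trans (sym fα≡fb) (heavy-colour (α-heavy v))))
    (λ fα≡fc → light-colour {v} (inj₂ refl) (trans (sym fα≡fc) (heavy-colour (α-heavy v))))
    (Pat.fb≢fc v)
    (trans σ₁≡σ₂ (cong (λ x → orientation (f v) x (f (c v))) fα′≡fα))
    where
    fα′≡fα : f (α′ v) ≡ f (α v)
    fα′≡fα = trans (heavy-colour (α′-heavy v)) (sym (heavy-colour (α-heavy v)))

  record CyclicTriangle (x y z : Fin n) : Set where
    field
      x→y : Heavy x y
      y→z : Heavy y z
      z→x : Heavy z x

  rotate : ∀ {x y z} → CyclicTriangle x y z → CyclicTriangle y z x
  rotate t = record { x→y = y→z ; y→z = z→x ; z→x = x→y }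
    where open CyclicTriangle t

  cyclic-triangle : ∀ {v y z} → Heavy v y → Light v z → Adj G y z → CyclicTriangle v y z
  cyclic-triangle {v} {y} {z} v→y light yz = record
    { x→y = v→y
    ; y→z = light⇒heavy (Adj-sym G yz) (light-if-colour-differs (Adj-sym G yz) λ fy≡ →
        colour-≢ (heavy-adj v→y) (sym (trans fy≡ (heavy-colour-of-light light))))
    ; z→x = light⇒heavy (light-adj light) light }

  first-triangle : ∀ v → CyclicTriangle v (α v) (b v)
  first-triangle v = cyclic-triangle (α-heavy v) (inj₁ refl) (Tri.α~b v)

  second-triangle : ∀ v → CyclicTriangle v (α′ v) (c v)
  second-triangle v = cyclic-triangle (α′-heavy v) (inj₂ refl) (Tri.α′~c v)

  apex-sides : ∀ {x y z} → CyclicTriangle x y z →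
    side x y ≡ orientation (f x) (f y) (f z) × side x z ≡ orientation (f x) (f y) (f z)
  apex-sides {x} t
    with heavy⇒α⊎α′ (CyclicTriangle.x→y t) | heavy⇒light (heavy-adj (CyclicTriangle.z→x t)) (CyclicTriangle.z→x t)
  ... | inj₁ refl | inj₁ refl = side-first (inj₁ refl) , side-first (inj₂ refl)
  ... | inj₁ refl | inj₂ refl = ⊥-elim (Tri.α≁c x (heavy-adj (CyclicTriangle.y→z t)))
  ... | inj₂ refl | inj₁ refl = ⊥-elim (Tri.α′≁b x (heavy-adj (CyclicTriangle.y→z t)))
  ... | inj₂ refl | inj₂ refl = side-second (inj₁ refl) , side-second (inj₂ refl)

  module _ {w y z : Fin n} (t : CyclicTriangle w y z) where
    private
      o : Bool
      o = orientation (f w) (f y) (f z)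
      at-y : side y z ≡ o × side y w ≡ o
      at-y with y-z , y-w ← apex-sides (rotate t) =
        trans y-z (sym rotate¹) , trans y-w (sym rotate¹)
        where
        rotate¹ : o ≡ orientation (f y) (f z) (f w)
        rotate¹ = orientation-rotate (f w) (f y) (f z)
      at-z : side z w ≡ o × side z y ≡ o
      at-z with z-w , z-y ← apex-sides (rotate (rotate t)) =
        trans z-w (sym rotate²) , trans z-y (sym rotate²)
        where
        rotate² : o ≡ orientation (f z) (f w) (f y)
        rotate² = trans (orientation-rotate (f w) (f y) (f z)) (orientation-rotate (f y) (f z) (f w))

    cyclic-triangle-side-sym : ∀ {u} → u ≡ y ⊎ u ≡ z → side w u ≡ side u w
    cyclic-triangle-side-sym (inj₁ refl) = trans (proj₁ (apex-sides t)) (sym (proj₂ at-y))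
    cyclic-triangle-side-sym (inj₂ refl) = trans (proj₂ (apex-sides t)) (sym (proj₁ at-z))

    cyclic-triangle-edge : ∀ {u v} → u ≡ y ⊎ u ≡ z → v ≡ y ⊎ v ≡ z → u ≢ v →
      Adj G u v × side u v ≡ side w u
    cyclic-triangle-edge (inj₁ refl) (inj₁ refl) u≢v = ⊥-elim (u≢v refl)
    cyclic-triangle-edge (inj₁ refl) (inj₂ refl) _ =
      heavy-adj (CyclicTriangle.y→z t) , trans (proj₁ at-y) (sym (proj₁ (apex-sides t)))
    cyclic-triangle-edge (inj₂ refl) (inj₁ refl) _ =
      Adj-sym G (heavy-adj (CyclicTriangle.y→z t)) , trans (proj₂ at-z) (sym (proj₂ (apex-sides t)))
    cyclic-triangle-edge (inj₂ refl) (inj₂ refl) u≢v = ⊥-elim (u≢v refl)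

  side-sym : ∀ {v w} → Adj G v w → side v w ≡ side w v
  side-sym {v} vw = [ cyclic-triangle-side-sym (first-triangle v) , cyclic-triangle-side-sym (second-triangle v) ]′
    (first-or-second vw)

  side-trans : ∀ {w u v} → Adj G w u → Adj G w v → u ≢ v → side w u ≡ side w v →
    Adj G u v × side u v ≡ side w u
  side-trans {w} wu wv u≢v same-side with first-or-second wu | first-or-second wv
  ... | inj₁ first | inj₁ first′ = cyclic-triangle-edge (first-triangle w) first first′ u≢v
  ... | inj₂ second | inj₂ second′ = cyclic-triangle-edge (second-triangle w) second second′ u≢v
  ... | inj₁ first | inj₂ second =
    ⊥-elim (σ₁≢σ₂ w (trans (sym (side-first first)) (trans same-side (side-second second))))
  ... | inj₂ second | inj₁ first =
    ⊥-elim (σ₁≢σ₂ w (trans (sym (side-first first)) (trans (sym same-side) (side-second second))))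

theorem15 : ∀ {n : ℕ} (G : Graph n) → ClawFree G → Regular 4 G → StarColourable 4 G →
    IsLineGraphOfBipartite G × OddHoleFree G
theorem15 G claw-free regular (f , star) = line-graph-G , line-graph-of-bipartite⇒odd-hole-free G line-graph-G
  where
  open ClawFreeQuarticStarColouring G claw-free regular star using (side; side-sym; side-trans)
  line-graph-G = line-graph G side side-sym side-trans
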